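{- The group $(\mathcal{A},\bullet)$ is the internal direct sum $\mathcal{A}=U\oplus C$, and $U=V\oplus W$, where $U:=\{f\in\mathcal{A}: f(0)=1\}$, $C:=\{ce: c\in\mathbb{C},\ c\neq0\}$, $V:=\{f\in\mathcal{A}: f(k_1+k_2)=f(k_1)f(k_2)\text{ for all }k_1,k_2\in\mathbb{N}_0\}$, and $W:=\{f\in\mathcal{A}: f(0)=1,\ f(1)=0\}$.
   Context: An arithmetic function is a map $\mathbb{N}_0\to\mathbb{C}$, $\mathbb{N}_0$ the nonnegative integers. The Cauchy-type product is $(f\bullet g)(k):=\sum_{m=0}^{k}\binom{k}{m}f(m)g(k-m)$. $\mathcal{A}$ is the set of arithmetic functions $f$ with $f(0)\neq0$, an abelian group under $\bullet$ with identity $e$, where $e(0)=1$, $e(k)=0$ for $k>0$; $ce$ denotes $k\mapsto c\,e(k)$. $U,C,V,W$ are subgroups of $(\mathcal{A},\bullet)$. -}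

module Defs where

open import Level using (Level; _⊔_)
open import Data.Nat using (ℕ; zero; suc) renaming (_+_ to _+ℕ_)
open import Data.Nat.Combinatorics using (_C_)
open import Data.Product using (Σ; _×_; _,_)
open import Relation.Nullary using (¬_)
open import Algebra.Bundles using (CommutativeRing)

record Field (c ℓ : Level) : Set (Level.suc (c ⊔ ℓ)) where
  field
    commutativeRing : CommutativeRing c ℓ
  open CommutativeRing commutativeRing public
  field
    1≉0     : ¬ (1# ≈ 0#)
    inverse : ∀ x → ¬ (x ≈ 0#) → Σ Carrier (λ y → x * y ≈ 1#)

module ArithmeticFunctions {c ℓ : Level} (K : Field c ℓ) where
  open Field K hiding (zero)

  Arith : Set c
  Arith = ℕ → Carrier

  _≋_ : Arith → Arith → Set ℓ
  f ≋ g = ∀ k → f k ≈ g k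

  ⟦_⟧ : ℕ → Carrier
  ⟦ zero ⟧  = 0#
  ⟦ suc n ⟧ = 1# + ⟦ n ⟧

  sumTo : ℕ → (ℕ → Carrier) → Carrier
  sumTo zero    t = t 0
  sumTo (suc n) t = sumTo n t + t (suc n)

  -- truncated subtraction on ℕ (only used with m ≤ k)
  _-ℕ_ : ℕ → ℕ → ℕ
  n     -ℕ zero  = n
  zero  -ℕ suc m = zero
  suc n -ℕ suc m = n -ℕ m

  _•_ : Arith → Arith → Arith
  (f • g) k = sumTo k (λ m → ⟦ k C m ⟧ * (f m * g (k -ℕ m)))

  e : Arith
  e zero    = 1#
  e (suc _) = 0#

  _·e : Carrier → Arith
  (a ·e) k = a * e k

  inA : Arith → Set ℓ
  inA f = ¬ (f 0 ≈ 0#)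

  inU : Arith → Set ℓ
  inU f = inA f × (f 0 ≈ 1#)

  inC : Arith → Set (c ⊔ ℓ)
  inC f = inA f × Σ Carrier (λ a → ¬ (a ≈ 0#) × (f ≋ (a ·e)))

  inV : Arith → Set ℓ
  inV f = inA f × (∀ k₁ k₂ → f (k₁ +ℕ k₂) ≈ f k₁ * f k₂)

  inW : Arith → Set ℓ
  inW f = inA f × ((f 0 ≈ 1#) × (f 1 ≈ 0#))

  IsInternalDirectSum : (G H J : Arith → Set (c ⊔ ℓ)) → Set (c ⊔ ℓ)
  IsInternalDirectSum G H J =
      (∀ f → H f → G f)
    × (∀ f → J f → G f)
    × (∀ f → G f → Σ Arith (λ h → Σ Arith (λ j → H h × J j × (f ≋ (h • j)))))
    × (∀ f → H f → J f → f ≋ e)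

-- Both decompositions are explicit.
--   * 𝒜 = U ⊕ C: an f ∈ 𝒜 factors as f = (f · f(0)⁻¹) • (f(0) e), because
--     convolving with a constant multiple a e of the identity only scales by a
--     (`•-scale`).  A function ce with c e(0) = 1 is e itself.
--   * U = V ⊕ W: for f ∈ U put a = f(1), take the exponential v(k) = aᵏ ∈ V
--     and let w be the solution of v • w = f.  Since v(0) = 1, this equation
--     is triangular: (v • w)(n+1) = w(n+1) + (terms involving w(0..n))
--     (`•-suc`), so w is obtained by course-of-values recursion
--     (`quotient`, built with well-founded recursion on ℕ).  Computing the
--     first value gives w(1) = f(1) − a = 0, so w ∈ W.  An f ∈ V ∩ W is e,
--     since f(k+1) = f(1) f(k) = 0; and V ⊆ U because f(0) is a nonzero
--     idempotent.

module Submission where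

open import Defs
open import Level using (Lift; lift; lower)
open import Data.Product using (_×_; _,_; proj₁; proj₂; Σ)
open import Data.Nat using (ℕ; zero; suc; _≤_; _<_; _∸_; z≤n; s≤s) renaming (_+_ to _+ℕ_)
open import Data.Nat.Properties using (≤-refl; m≤n⇒m≤1+n; n∸n≡0; m∸n≤m; m<n⇒0<n∸m)
open import Data.Nat.Combinatorics using (_C_; nCn≡1)
open import Data.Nat.Induction using (<-wellFounded; <-rec)
open import Induction.WellFounded using (WfRec; module FixPoint)
open import Relation.Nullary using (¬_)
open import Relation.Binary.PropositionalEquality as P using (_≡_)
import Relation.Binary.Reasoning.Setoid as SetoidReasoning

module Splittings {c ℓ : Level.Level} (K : Field c ℓ) where
  open Field K hiding (zero)
  open ArithmeticFunctions K
  open SetoidReasoning setoid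

  idempotent⇒one : ∀ x → ¬ (x ≈ 0#) → x * x ≈ x → x ≈ 1#
  idempotent⇒one x x≉0 xx≈x = begin
    x             ≈⟨ sym (*-identityʳ x) ⟩
    x * 1#        ≈⟨ *-cong refl (sym xy≈1) ⟩
    x * (x * y)   ≈⟨ sym (*-assoc x x y) ⟩
    (x * x) * y   ≈⟨ *-cong xx≈x refl ⟩
    x * y         ≈⟨ xy≈1 ⟩
    1#            ∎
    where
    y = proj₁ (inverse x x≉0)
    xy≈1 = proj₂ (inverse x x≉0)

  minus-plus : ∀ x y → (x + - y) + y ≈ x
  minus-plus x y = begin
    (x + - y) + y  ≈⟨ +-assoc x (- y) y ⟩
    x + (- y + y)  ≈⟨ +-cong refl (-‿inverseˡ y) ⟩
    x + 0#         ≈⟨ +-identityʳ x ⟩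
    x              ∎

  -ℕ≡∸ : ∀ n m → n -ℕ m ≡ n ∸ m
  -ℕ≡∸ n       zero    = P.refl
  -ℕ≡∸ zero    (suc m) = P.refl
  -ℕ≡∸ (suc n) (suc m) = -ℕ≡∸ n m

  -- The index n -ℕ m is a valid recursive call when computing at n + 1.
  -ℕ<suc : ∀ n m → n -ℕ m < suc n
  -ℕ<suc n m = s≤s (P.subst (_≤ n) (P.sym (-ℕ≡∸ n m)) (m∸n≤m n m))

  ⟦1⟧ : ⟦ 1 ⟧ ≈ 1#
  ⟦1⟧ = +-identityʳ 1#

  ⟦nCn⟧ : ∀ n → ⟦ n C n ⟧ ≈ 1#
  ⟦nCn⟧ n = trans (reflexive (P.cong ⟦_⟧ (nCn≡1 n))) ⟦1⟧

  ⟦nC0⟧ : ∀ n → ⟦ n C 0 ⟧ ≈ 1#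
  ⟦nC0⟧ n = ⟦1⟧

  -- Finite sums respect pointwise propositional equality (needed for the
  -- unfolding equation of well-founded recursion).
  sumTo-cong≡ : ∀ n {t s : ℕ → Carrier} → (∀ m → t m ≡ s m) → sumTo n t ≡ sumTo n s
  sumTo-cong≡ zero    t≡s = t≡s 0
  sumTo-cong≡ (suc n) t≡s = P.cong₂ _+_ (sumTo-cong≡ n t≡s) (t≡s (suc n))

  sumTo-last : ∀ n (t : ℕ → Carrier) → (∀ m → m < n → t m ≈ 0#) → sumTo n t ≈ t n
  sumTo-last zero    t _      = refl
  sumTo-last (suc n) t vanish = begin
    sumTo n t + t (suc n)  ≈⟨ +-cong (sumTo-zero n (λ m m≤n → vanish m (s≤s m≤n))) refl ⟩
    0# + t (suc n)         ≈⟨ +-identityˡ _ ⟩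
    t (suc n)              ∎
    where
    sumTo-zero : ∀ k → (∀ m → m ≤ k → t m ≈ 0#) → sumTo k t ≈ 0#
    sumTo-zero zero    z = z 0 z≤n
    sumTo-zero (suc k) z = trans (+-cong (sumTo-zero k (λ m m≤k → z m (m≤n⇒m≤1+n m≤k)))
                                         (z (suc k) ≤-refl))
                                 (+-identityʳ 0#)

  sumTo-peel : ∀ n (t : ℕ → Carrier) → sumTo (suc n) t ≈ t 0 + sumTo n (λ m → t (suc m))
  sumTo-peel zero    t = refl
  sumTo-peel (suc n) t = trans (+-cong (sumTo-peel n t) refl) (+-assoc _ _ _)

  e-pos : ∀ {k} → 0 < k → e k ≈ 0#
  e-pos {suc k} _ = refl

  •-scale : ∀ h a k → (h • (a ·e)) k ≈ h k * a
  •-scale h a k = begin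
    (h • (a ·e)) k                          ≈⟨ sumTo-last k _ vanish ⟩
    ⟦ k C k ⟧ * (h k * (a * e (k -ℕ k)))    ≈⟨ *-cong (⟦nCn⟧ k) (*-cong refl (*-cong refl e0)) ⟩
    1# * (h k * (a * 1#))                   ≈⟨ *-identityˡ _ ⟩
    h k * (a * 1#)                          ≈⟨ *-cong refl (*-identityʳ a) ⟩
    h k * a                                 ∎
    where
    e0 : e (k -ℕ k) ≈ 1#
    e0 = reflexive (P.cong e (P.trans (-ℕ≡∸ k k) (n∸n≡0 k)))
    vanish : ∀ m → m < k → ⟦ k C m ⟧ * (h m * (a * e (k -ℕ m))) ≈ 0#
    vanish m m<k = begin
      ⟦ k C m ⟧ * (h m * (a * e (k -ℕ m)))  ≈⟨ *-cong refl (*-cong refl (*-cong refl ek-m≈0)) ⟩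
      ⟦ k C m ⟧ * (h m * (a * 0#))          ≈⟨ *-cong refl (*-cong refl (zeroʳ a)) ⟩
      ⟦ k C m ⟧ * (h m * 0#)                ≈⟨ *-cong refl (zeroʳ _) ⟩
      ⟦ k C m ⟧ * 0#                        ≈⟨ zeroʳ _ ⟩
      0#                                    ∎
      where
      ek-m≈0 : e (k -ℕ m) ≈ 0#
      ek-m≈0 = e-pos (P.subst (0 <_) (P.sym (-ℕ≡∸ k m)) (m<n⇒0<n∸m m<k))

  -- The part of (g • w)(n+1) that only involves w(0), …, w(n).
  lower-terms : Arith → Arith → ℕ → Carrier
  lower-terms g w n = sumTo n (λ m → ⟦ suc n C suc m ⟧ * (g (suc m) * w (n -ℕ m)))

  -- If g(0) = 1, then (g • w)(n+1) = w(n+1) + lower-terms: the equation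
  -- g • w = f is triangular in w.
  •-suc : ∀ g w n → g 0 ≈ 1# → (g • w) (suc n) ≈ w (suc n) + lower-terms g w n
  •-suc g w n g0≈1 = trans (sumTo-peel n _) (+-cong first refl)
    where
    first : ⟦ suc n C 0 ⟧ * (g 0 * w (suc n)) ≈ w (suc n)
    first = begin
      ⟦ suc n C 0 ⟧ * (g 0 * w (suc n))  ≈⟨ *-cong (⟦nC0⟧ (suc n)) (*-cong g0≈1 refl) ⟩
      1# * (1# * w (suc n))              ≈⟨ *-identityˡ _ ⟩
      1# * w (suc n)                     ≈⟨ *-identityˡ _ ⟩
      w (suc n)                          ∎

  -- Division by g with g(0) = 1: the function w with w(0) = f(0) and
  -- w(n+1) = f(n+1) − lower-terms g w n, defined by course-of-values recursion.
  quotient-step : (g f : Arith) → ∀ n → WfRec _<_ (λ _ → Carrier) n → Carrier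
  quotient-step g f zero    _      = f 0
  quotient-step g f (suc n) w<suc-n =
    f (suc n) + - sumTo n (λ m → ⟦ suc n C suc m ⟧ * (g (suc m) * w<suc-n (-ℕ<suc n m)))

  quotient : Arith → Arith → Arith
  quotient g f = <-rec (λ _ → Carrier) (quotient-step g f)

  quotient-step-ext : ∀ g f n {w w′ : WfRec _<_ (λ _ → Carrier) n} →
    (∀ {y} (y<n : y < n) → w y<n ≡ w′ y<n) → quotient-step g f n w ≡ quotient-step g f n w′
  quotient-step-ext g f zero    _   = P.refl
  quotient-step-ext g f (suc n) w≡w′ =
    P.cong (λ s → f (suc n) + - s)
           (sumTo-cong≡ n (λ m → P.cong (λ x → ⟦ suc n C suc m ⟧ * (g (suc m) * x)) (w≡w′ (-ℕ<suc n m))))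

  quotient-unfold : ∀ g f n → quotient g f n ≡ quotient-step g f n (λ {y} _ → quotient g f y)
  quotient-unfold g f n = FixPoint.unfold-wfRec <-wellFounded (λ _ → Carrier) (quotient-step g f) (quotient-step-ext g f) {n}

  quotient-zero : ∀ g f → quotient g f 0 ≡ f 0
  quotient-zero g f = quotient-unfold g f 0

  quotient-suc : ∀ g f n → quotient g f (suc n) ≡ f (suc n) + - lower-terms g (quotient g f) n
  quotient-suc g f n = quotient-unfold g f (suc n)

  •-quotient : ∀ g f → g 0 ≈ 1# → (g • quotient g f) ≋ f
  •-quotient g f g0≈1 zero = begin
    ⟦ 0 C 0 ⟧ * (g 0 * w 0)  ≈⟨ *-cong (⟦nCn⟧ 0) (*-cong g0≈1 (reflexive (quotient-zero g f))) ⟩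
    1# * (1# * f 0)          ≈⟨ *-identityˡ _ ⟩
    1# * f 0                 ≈⟨ *-identityˡ _ ⟩
    f 0                      ∎
    where w = quotient g f
  •-quotient g f g0≈1 (suc n) = begin
    (g • w) (suc n)                             ≈⟨ •-suc g w n g0≈1 ⟩
    w (suc n) + lower-terms g w n               ≈⟨ +-cong (reflexive (quotient-suc g f n)) refl ⟩
    (f (suc n) + - lower-terms g w n) + lower-terms g w n
                                                ≈⟨ minus-plus _ _ ⟩
    f (suc n)                                   ∎
    where w = quotient g f

  expo : Carrier → Arith
  expo a zero    = 1#
  expo a (suc k) = a * expo a k

  expo-+ : ∀ a m n → expo a (m +ℕ n) ≈ expo a m * expo a n
  expo-+ a zero    n = sym (*-identityˡ _)
  expo-+ a (suc m) n = trans (*-cong refl (expo-+ a m n)) (sym (*-assoc _ _ _))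

  expo∈V : ∀ a → inV (expo a)
  expo∈V a = 1≉0 , expo-+ a

  normalised⇒inU : ∀ {f} → f 0 ≈ 1# → inU f
  normalised⇒inU f0≈1 = (λ f0≈0 → 1≉0 (trans (sym f0≈1) f0≈0)) , f0≈1

  -- V ⊆ U: f(0) = f(0 + 0) = f(0)² is a nonzero idempotent.
  V⊆U : ∀ {f} → inV f → inU f
  V⊆U {f} (f0≉0 , f-hom) = f0≉0 , idempotent⇒one (f 0) f0≉0 (sym (f-hom 0 0))

  𝒜-factor : ∀ f → inA f → Σ Arith (λ h → Σ Arith (λ j → inU h × inC j × (f ≋ (h • j))))
  𝒜-factor f f0≉0 = h , (a ·e) , normalised⇒inU {h} ab≈1 , (ae∈𝒜 , a , f0≉0 , λ _ → refl) , f≋h•ae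
    where
    a = f 0
    b = proj₁ (inverse a f0≉0)
    ab≈1 = proj₂ (inverse a f0≉0)
    h : Arith
    h k = f k * b
    ae∈𝒜 : inA (a ·e)
    ae∈𝒜 ae0≈0 = f0≉0 (trans (sym (*-identityʳ a)) ae0≈0)
    f≋h•ae : f ≋ (h • (a ·e))
    f≋h•ae k = sym (begin
      (h • (a ·e)) k  ≈⟨ •-scale h a k ⟩
      (f k * b) * a   ≈⟨ *-assoc _ _ _ ⟩
      f k * (b * a)   ≈⟨ *-cong refl (trans (*-comm b a) ab≈1) ⟩
      f k * 1#        ≈⟨ *-identityʳ _ ⟩
      f k             ∎)

  U-factor : ∀ f → inU f → Σ Arith (λ v → Σ Arith (λ w → inV v × inW w × (f ≋ (v • w))))
  U-factor f (_ , f0≈1) = v , w , expo∈V a , w∈W , λ k → sym (•-quotient v f refl k)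
    where
    a = f 1
    v = expo a
    w = quotient v f
    w0≈1 : w 0 ≈ 1#
    w0≈1 = trans (reflexive (quotient-zero v f)) f0≈1
    lower-term≈a : ⟦ 1 C 1 ⟧ * ((a * 1#) * w 0) ≈ a
    lower-term≈a = begin
      ⟦ 1 C 1 ⟧ * ((a * 1#) * w 0)  ≈⟨ *-cong (⟦nCn⟧ 1) (*-cong (*-identityʳ a) w0≈1) ⟩
      1# * (a * 1#)                 ≈⟨ *-identityˡ _ ⟩
      a * 1#                        ≈⟨ *-identityʳ a ⟩
      a                             ∎
    w1≈0 : w 1 ≈ 0#
    w1≈0 = begin
      w 1                                     ≈⟨ reflexive (quotient-suc v f 0) ⟩
      f 1 + - (⟦ 1 C 1 ⟧ * ((a * 1#) * w 0))  ≈⟨ +-cong refl (-‿cong lower-term≈a) ⟩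
      f 1 + - a                               ≈⟨ -‿inverseʳ a ⟩
      0#                                      ∎
    w∈W : inW w
    w∈W = proj₁ (normalised⇒inU {w} w0≈1) , w0≈1 , w1≈0

  𝒜=U⊕C : IsInternalDirectSum (λ f → Lift c (inA f)) (λ f → Lift c (inU f)) inC
  𝒜=U⊕C = (λ _ u → lift (proj₁ (lower u))) , (λ _ j → lift (proj₁ j)) , factor , U∩C
    where
    factor : ∀ f → Lift c (inA f) → Σ Arith (λ h → Σ Arith (λ j → Lift c (inU h) × inC j × (f ≋ (h • j))))
    factor f (lift f∈𝒜) with 𝒜-factor f f∈𝒜
    ... | h , j , h∈U , j∈C , f≋h•j = h , j , lift h∈U , j∈C , f≋h•j
    U∩C : ∀ f → Lift c (inU f) → inC f → f ≋ e
    U∩C f (lift (_ , f0≈1)) _                  zero    = f0≈1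
    U∩C f _                 (_ , a , _ , f≋ae) (suc k) = trans (f≋ae (suc k)) (zeroʳ a)

  -- U = V ⊕ W; an f ∈ V ∩ W satisfies f(k+1) = f(1) f(k) = 0.
  U=V⊕W : IsInternalDirectSum (λ f → Lift c (inU f)) (λ f → Lift c (inV f)) (λ f → Lift c (inW f))
  U=V⊕W = (λ _ v → lift (V⊆U (lower v))) , (λ _ w → lift (proj₁ (lower w) , proj₁ (proj₂ (lower w))))
        , factor , V∩W
    where
    factor : ∀ f → Lift c (inU f) → Σ Arith (λ v → Σ Arith (λ w → Lift c (inV v) × Lift c (inW w) × (f ≋ (v • w))))
    factor f (lift f∈U) with U-factor f f∈U
    ... | v , w , v∈V , w∈W , f≋v•w = v , w , lift v∈V , lift w∈W , f≋v•w
    V∩W : ∀ f → Lift c (inV f) → Lift c (inW f) → f ≋ e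
    V∩W f _                  (lift (_ , f0≈1 , _))   zero    = f0≈1
    V∩W f (lift (_ , f-hom)) (lift (_ , _ , f1≈0)) (suc k) =
      trans (f-hom 1 k) (trans (*-cong f1≈0 refl) (zeroˡ _))

theorem18 : ∀ {c ℓ} (K : Field c ℓ) → let open ArithmeticFunctions K in
    IsInternalDirectSum (λ f → Lift c (inA f)) (λ f → Lift c (inU f)) inC
    × IsInternalDirectSum (λ f → Lift c (inU f)) (λ f → Lift c (inV f)) (λ f → Lift c (inW f))
theorem18 K = Splittings.𝒜=U⊕C K , Splittings.U=V⊕W K
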